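{- Let $G=(V,E,x)$ be a topology, $k\ge1$, and $\bar g=(g_1,\dots,g_k)$ a tuple of distinct vertices. For integers $0\le j<d$ and vertices $u,v\in V$, if $u\sim_d v$ then $u\sim_j v$ (i.e., $\sim_d$ refines $\sim_j$).
   Context: Let $\Lambda(v)=\{i\}$ if $v=g_i$ and $\Lambda(v)=\emptyset$ if $v\notin\bar g$. For $v\in V$, let $X(v)$ be the set of finite paths $\pi_1\dots\pi_t$ in $G$ (consecutive vertices joined by edges of $E$, $t\ge1$) with $\pi_1=v$, $\pi_1,\dots,\pi_{t-1}\notin\bar g$, and $\pi_t\in\bar g$ (so $X(g_i)=\{g_i\}$). For a finite word $w$, $\mathrm{destut}(w)$ is the word obtained by collapsing every maximal block of identical consecutive letters into a single letter. Define markings: $\mu_0(v)=\Lambda(v)$, and for $d>0$, $\mu_d(v)=\{\mathrm{destut}(\mu_{d-1}(\pi_1)\cdots\mu_{d-1}(\pi_t)):\pi_1\dots\pi_t\in X(v)\}$, a set of words over the alphabet $\{\mu_{d-1}(w):w\in V\}$. Vertices $u,v$ are $d$-equivalent, $u\sim_d v$, iff $\mu_d(u)=\mu_d(v)$. -}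

module Defs where

open import Data.Nat using (ℕ; zero; suc)
open import Data.Fin using (Fin)
open import Data.List using (List; []; _∷_)
open import Data.List.Relation.Binary.Pointwise using (Pointwise)
open import Data.Product using (Σ; ∃; _×_)
open import Relation.Nullary using (¬_)
open import Relation.Binary.PropositionalEquality using (_≡_)

-- A topology G = (V, E, x): vertex set V = Fin n, edge relation E, distinguished vertex x.
-- ḡ = (g_1,…,g_k) is given as g : Fin k → Fin n.

InG : ∀ {n k} → (Fin k → Fin n) → Fin n → Set
InG g v = Σ _ λ i → v ≡ g i

data X {n k} (E : Fin n → Fin n → Set) (g : Fin k → Fin n)
       : Fin n → List (Fin n) → Set where
  stop : ∀ {v} → InG g v → X E g v (v ∷ [])
  step : ∀ {v w π} → ¬ InG g v → E v w → X E g w (w ∷ π) → X E g v (v ∷ w ∷ π)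

-- Destut R w s : s is destut(w) where letters are compared up to the equivalence R
-- (a letter a stands for the marking μ_{d-1}(a), and R a b means μ_{d-1}(a) = μ_{d-1}(b)).
data Destut {A : Set} (R : A → A → Set) : List A → List A → Set where
  nil  : Destut R [] []
  one  : ∀ {a} → Destut R (a ∷ []) (a ∷ [])
  same : ∀ {a b w s} → R a b → Destut R (b ∷ w) s → Destut R (a ∷ b ∷ w) s
  diff : ∀ {a b w s} → ¬ R a b → Destut R (b ∷ w) s → Destut R (a ∷ b ∷ w) (a ∷ s)

DEq : {A : Set} → (A → A → Set) → List A → List A → Set
DEq R w w' = ∃ λ s → ∃ λ s' → Destut R w s × Destut R w' s' × Pointwise R s s'

Sim : ∀ {n k} → (Fin n → Fin n → Set) → (Fin k → Fin n) → ℕ → Fin n → Fin n → Set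
Sim E g zero u v = ∀ i → ((u ≡ g i → v ≡ g i) × (v ≡ g i → u ≡ g i))
Sim {n} E g (suc d) u v = Incl u v × Incl v u
  where
  Incl : Fin n → Fin n → Set
  Incl a b = ∀ π → X E g a π → ∃ λ π' → X E g b π' × DEq (Sim E g d) π π'

-- By induction on d it suffices to show that ∼_{d+1} refines ∼_d. For d = 0 the path g_i ∈ X(g_i)
-- forces every matching path from v to destutter to a single letter Λ-equivalent to g_i. For the
-- step, every vertex on a path from u has a ∼_{d+1}-partner, which makes ∼_d decidable along the path,
-- so its ∼_d-destuttering exists; destuttering at the finer ∼_{d+1} and then at the coarser ∼_d gives
-- the same word, and destuttering preserves letterwise equivalence of words.
module Submission where

open import Defs
open import Data.Nat using (ℕ; zero; suc; _≤_; _<_; _≤′_; ≤′-refl; ≤′-step)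
open import Data.Nat.Properties using (≤⇒≤′)
open import Data.Fin using (Fin)
open import Data.List using ([]; _∷_)
open import Data.List.Relation.Binary.Pointwise as Pointwise using (Pointwise; []; _∷_)
open import Data.List.Relation.Binary.Pointwise.Properties as Pointwiseₚ using ()
open import Data.List.Relation.Unary.All using (All; []; _∷_)
open import Data.List.Relation.Unary.Linked using (Linked; []; [-]; _∷_)
open import Data.Product using (∃; ∃₂; _×_; _,_; proj₁; proj₂)
open import Data.Empty using (⊥-elim)
open import Function using (_∘_)
open import Function.Definitions using (Injective)
open import Relation.Binary.Core using (_⇒_)
open import Relation.Binary.Definitions using (Symmetric; Transitive)
open import Relation.Binary.Construct.Closure.Reflexive using (ReflClosure; refl; [_])
open import Relation.Binary.PropositionalEquality using (_≡_; refl; cong)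
open import Relation.Nullary using (¬_; Dec; yes; no)

module _ {A : Set} {R : A → A → Set} where

  Destut-functional : ∀ {w s s′} → Destut R w s → Destut R w s′ → s ≡ s′
  Destut-functional nil         nil          = refl
  Destut-functional one         one          = refl
  Destut-functional (same _ D)  (same _ D′)  = Destut-functional D D′
  Destut-functional (same r _)  (diff ¬r _)  = ⊥-elim (¬r r)
  Destut-functional (diff ¬r _) (same r _)   = ⊥-elim (¬r r)
  Destut-functional (diff _ D)  (diff _ D′)  = cong (_ ∷_) (Destut-functional D D′)

  Destut-exists : ∀ {w} → Linked (λ a b → Dec (R a b)) w → ∃ (Destut R w)
  Destut-exists []             = [] , nil
  Destut-exists [-]            = _ , one
  Destut-exists (yes a∼b ∷ ds) = let s , D = Destut-exists ds in s , same a∼b D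
  Destut-exists (no a≁b ∷ ds)  = let s , D = Destut-exists ds in _ , diff a≁b D

  Destut-dec : ∀ {a b w s} → Destut R (a ∷ b ∷ w) s → Dec (R a b)
  Destut-dec (same a∼b _) = yes a∼b
  Destut-dec (diff a≁b _) = no a≁b

  Destut-partners : ∀ {w s s′} → Destut R w s → Pointwise R s s′ → All (λ a → ∃ (R a)) w
  Destut-partners nil          []            = []
  Destut-partners one          (a∼a′ ∷ [])   = (_ , a∼a′) ∷ []
  Destut-partners (same a∼b D) ss′           = (_ , a∼b) ∷ Destut-partners D ss′
  Destut-partners (diff _ D)   (a∼a′ ∷ ss′)  = (_ , a∼a′) ∷ Destut-partners D ss′

  module _ (trans : Transitive R) where

    Destut-head : ∀ {b w s} → Destut R (b ∷ w) s → ∃₂ λ c s₀ → s ≡ c ∷ s₀ × ReflClosure R b c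
    Destut-head one = _ , _ , refl , refl
    Destut-head (diff _ _) = _ , _ , refl , refl
    Destut-head (same a∼b D) with Destut-head D
    ... | c , s₀ , eq , refl     = c , s₀ , eq , [ a∼b ]
    ... | c , s₀ , eq , [ b∼c ]  = c , s₀ , eq , [ trans a∼b b∼c ]

    module _ (sym : Symmetric R) where

      Destut-pointwise : ∀ {s s′ t t′} → Pointwise R s s′ →
                         Destut R s t → Destut R s′ t′ → Pointwise R t t′
      Destut-pointwise []                      nil          nil           = []
      Destut-pointwise (a∼a′ ∷ [])             one          one           = a∼a′ ∷ []
      Destut-pointwise (_ ∷ ss′)               (same _ D)   (same _ D′)   = Destut-pointwise ss′ D D′
      Destut-pointwise (a∼a′ ∷ ss′)            (diff _ D)   (diff _ D′)   = a∼a′ ∷ Destut-pointwise ss′ D D′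
      Destut-pointwise (a∼a′ ∷ b∼b′ ∷ _)       (same a∼b _) (diff a′≁b′ _) =
        ⊥-elim (a′≁b′ (trans (sym a∼a′) (trans a∼b b∼b′)))
      Destut-pointwise (a∼a′ ∷ b∼b′ ∷ _)       (diff a≁b _) (same a′∼b′ _) =
        ⊥-elim (a≁b (trans a∼a′ (trans a′∼b′ (sym b∼b′))))

module _ {A : Set} {R R′ : A → A → Set} (R⇒R′ : R ⇒ R′) (R-trans : Transitive R)
         (R′-sym : Symmetric R′) (R′-trans : Transitive R′) where

  private
    ∼-reflClosure : ∀ {a b c} → R′ a b → ReflClosure R b c → R′ a c
    ∼-reflClosure a∼b refl      = a∼b
    ∼-reflClosure a∼b [ b∼c ]   = R′-trans a∼b (R⇒R′ b∼c)

    ≁-reflClosure : ∀ {a b c} → ¬ R′ a b → ReflClosure R b c → ¬ R′ a c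
    ≁-reflClosure a≁b refl      = a≁b
    ≁-reflClosure a≁b [ b∼c ] a∼c = a≁b (R′-trans a∼c (R′-sym (R⇒R′ b∼c)))

  Destut-coarsen : ∀ {w s t} → Destut R w s → Destut R′ w t → Destut R′ s t
  Destut-coarsen nil          nil            = nil
  Destut-coarsen one          one            = one
  Destut-coarsen (same _ D)   (same _ D′)    = Destut-coarsen D D′
  Destut-coarsen (same a∼b _) (diff a≁b _)   = ⊥-elim (a≁b (R⇒R′ a∼b))
  Destut-coarsen (diff _ D)   (same a∼b D′)  with Destut-head R-trans D
  ... | _ , _ , refl , b∼c = same (∼-reflClosure a∼b b∼c) (Destut-coarsen D D′)
  Destut-coarsen (diff _ D)   (diff a≁b D′)  with Destut-head R-trans D
  ... | _ , _ , refl , b∼c = diff (≁-reflClosure a≁b b∼c) (Destut-coarsen D D′)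

module _ {n k : ℕ} (E : Fin n → Fin n → Set) (g : Fin k → Fin n) where

  MarkingIncl : ℕ → Fin n → Fin n → Set
  MarkingIncl d u v = ∀ π → X E g u π → ∃ λ π′ → X E g v π′ × DEq (Sim E g d) π π′

  X-head : ∀ {v π} → X E g v π → ∃ λ π₀ → π ≡ v ∷ π₀
  X-head (stop _)     = _ , refl
  X-head (step _ _ _) = _ , refl

  Sim-sym : ∀ d → Symmetric (Sim E g d)
  Sim-sym zero    u∼v i        = proj₂ (u∼v i) , proj₁ (u∼v i)
  Sim-sym (suc d) (u⊑v , v⊑u)  = v⊑u , u⊑v

  MarkingIncl-trans : ∀ d {u v w} → MarkingIncl d u v → MarkingIncl d v w → MarkingIncl d u w

  Sim-trans : ∀ d → Transitive (Sim E g d)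
  Sim-trans zero    u∼v v∼w i = proj₁ (v∼w i) ∘ proj₁ (u∼v i) , proj₂ (u∼v i) ∘ proj₂ (v∼w i)
  Sim-trans (suc d) (u⊑v , v⊑u) (v⊑w , w⊑v) = MarkingIncl-trans d u⊑v v⊑w , MarkingIncl-trans d w⊑v v⊑u

  MarkingIncl-trans d u⊑v v⊑w π xπ with u⊑v π xπ
  ... | π′ , xπ′ , s , s′ , D , D′ , s∼s′ with v⊑w π′ xπ′
  ... | π″ , xπ″ , s′₁ , s″ , D′₁ , D″ , s′∼s″ with Destut-functional D′ D′₁
  ... | refl = π″ , xπ″ , s , s″ , D , D″ , Pointwiseₚ.transitive (Sim-trans d) s∼s′ s′∼s″

  MarkingIncl⇒Destut : ∀ d {u v π} → MarkingIncl d u v → X E g u π → ∃ (Destut (Sim E g d) π)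
  MarkingIncl⇒Destut d u⊑v xπ with u⊑v _ xπ
  ... | _ , _ , s , _ , D , _ = s , D

  X-Destut : ∀ d {u π} → X E g u π → All (λ a → ∃ (Sim E g (suc d) a)) π →
             ∃ (Destut (Sim E g d) π)
  X-Destut d xπ partners = Destut-exists (adjacent-dec xπ partners)
    where
    -- A partner a′ of a destutters the path a b … at level d, and that destuttering decides a ∼_d b.
    adjacent-dec : ∀ {u π} → X E g u π → All (λ a → ∃ (Sim E g (suc d) a)) π →
                   Linked (λ a b → Dec (Sim E g d a b)) π
    adjacent-dec (stop _)           _                   = [-]
    adjacent-dec x@(step _ _ xπ)    ((_ , a⊑a′ , _) ∷ ps) =
      Destut-dec (proj₂ (MarkingIncl⇒Destut d a⊑a′ x)) ∷ adjacent-dec xπ ps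

  MarkingIncl-zero⇒Λ : ∀ {u v} → MarkingIncl zero u v → ∀ i → u ≡ g i → v ≡ g i
  MarkingIncl-zero⇒Λ {u} u⊑v i u≡gᵢ with u⊑v (u ∷ []) (stop (i , u≡gᵢ))
  ... | _ , xπ′ , _ , _ , one , D′ , u∼c ∷ [] with X-head xπ′
  ... | _ , refl with Destut-head (Sim-trans zero) D′
  ... | _ , _ , refl , refl    = proj₁ (u∼c i) u≡gᵢ
  ... | _ , _ , refl , [ v∼c ] = proj₂ (v∼c i) (proj₁ (u∼c i) u≡gᵢ)

  MarkingIncl-lower : ∀ d → Sim E g (suc d) ⇒ Sim E g d →
                      ∀ {u v} → MarkingIncl (suc d) u v → MarkingIncl d u v
  MarkingIncl-lower d lower u⊑v π xπ with u⊑v π xπ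
  ... | π′ , xπ′ , s , s′ , D , D′ , s∼s′
      with X-Destut d xπ (Destut-partners D s∼s′)
         | X-Destut d xπ′ (Destut-partners D′ (Pointwiseₚ.symmetric (Sim-sym (suc d)) s∼s′))
  ... | t , T | t′ , T′ =
    π′ , xπ′ , t , t′ , T , T′ ,
    Destut-pointwise (Sim-trans d) (Sim-sym d) (Pointwise.map lower s∼s′) (coarsen D T) (coarsen D′ T′)
    where
    coarsen : ∀ {w s t} → Destut (Sim E g (suc d)) w s → Destut (Sim E g d) w t → Destut (Sim E g d) s t
    coarsen = Destut-coarsen lower (Sim-trans (suc d)) (Sim-sym d) (Sim-trans d)

  Sim-suc⇒Sim : ∀ d → Sim E g (suc d) ⇒ Sim E g d
  Sim-suc⇒Sim zero    (u⊑v , v⊑u) i = MarkingIncl-zero⇒Λ u⊑v i , MarkingIncl-zero⇒Λ v⊑u i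
  Sim-suc⇒Sim (suc d) (u⊑v , v⊑u)   = lower u⊑v , lower v⊑u
    where
    lower : ∀ {a b} → MarkingIncl (suc d) a b → MarkingIncl d a b
    lower = MarkingIncl-lower d (Sim-suc⇒Sim d)

  Sim-refines : ∀ {j d} → suc j ≤′ d → Sim E g d ⇒ Sim E g j
  Sim-refines ≤′-refl     = Sim-suc⇒Sim _
  Sim-refines (≤′-step p) = Sim-refines p ∘ Sim-suc⇒Sim _

lemma1 : (n : ℕ) (E : Fin n → Fin n → Set) (x : Fin n)
         (k : ℕ) → 1 ≤ k → (g : Fin k → Fin n) → Injective _≡_ _≡_ g →
         (j d : ℕ) → j < d → (u v : Fin n) →
         Sim E g d u v → Sim E g j u v
lemma1 n E x k _ g _ j d j<d u v = Sim-refines E g (≤⇒≤′ j<d)
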